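{- For each graph $X$, the functors $\mathsf{Fib}_X\colon\mathsf{Cov}(X)\to\mathsf{Set}^{\Pi_1X}$ and $\mathsf{Tot}_X\colon\mathsf{Set}^{\Pi_1X}\to\mathsf{Cov}(X)$ define an equivalence of categories.
   Context: Graphs are simple undirected loopless graphs; graph maps send adjacent vertices to equal or adjacent vertices. $I_n$ has vertices $0,\dots,n$, edges $i\sim i+1$; $I_1\square I_1$ is the $4$-cycle with vertices $(a,b)\in\{0,1\}^2$, $(a,b)\sim(a',b')$ iff they differ in exactly one coordinate. A path of length $n$ from $x$ to $x'$ is a graph map $\gamma\colon I_n\to X$ with $\gamma(0)=x$, $\gamma(n)=x'$. The fundamental groupoid $\Pi_1X$ has objects the vertices of $X$ and morphisms $x\to x'$ the path-homotopy classes $[\gamma]$ of paths $x\rightsquigarrow x'$ (path-components of the quotient of $\coprod_n P_nX(x,x')$ by reparametrization along surjective order-preserving maps $I_m\to I_n$, where $P_nX(x,x')$ has paths of length $n$ as vertices, two being adjacent iff distinct and pointwise equal-or-adjacent), with $[\sigma]\circ[\gamma]=[\gamma\ast\sigma]$ (concatenation). A graph map $p\colon Y\to X$ is a covering map if (i) for every vertex $y$, $p$ restricts to a bijection from $\{y\}\cup\{\text{neighbours of }y\}$ onto $\{p(y)\}\cup\{\text{neighbours of }p(y)\}$, and (ii) for all graph maps $u\colon I_3\to Y$ and $v\colon I_1\square I_1\to X$ with $p(u(0))=v(1,0)$, $p(u(1))=v(0,0)$, $p(u(2))=v(0,1)$, $p(u(3))=v(1,1)$, one has $u(0)=u(3)$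 or $u(0)\sim u(3)$. $\mathsf{Cov}(X)$ has objects the covering maps $p\colon Y\to X$ and morphisms $p\to p'$ the graph maps $f\colon Y\to Y'$ with $p'\circ f=p$. For a covering $p$, every path $\gamma\colon x\rightsquigarrow x'$ and $y\in p^{ -1}(x)$ have a unique path $\tilde\gamma$ starting at $y$ with $p\circ\tilde\gamma=\gamma$, and its endpoint depends only on $[\gamma]$; this defines $\mathsf{unw}_{[\gamma]}\colon p^{ -1}(x)\to p^{ -1}(x')$. $\mathsf{Fib}_X(p)\colon\Pi_1X\to\mathsf{Set}$ sends $x\mapsto p^{ -1}(x)$, $[\gamma]\mapsto\mathsf{unw}_{[\gamma]}$; on a morphism $f$ it is the natural transformation with components $f|_{p^{ -1}(x)}$. For a functor $F\colon\Pi_1X\to\mathsf{Set}$, the total graph $\mathsf{Tot}_XF$ has vertex set $\coprod_{x}Fx$, with $y\in Fx$ adjacent to $y'\in Fx'$ iff $x\sim x'$ in $X$ and $F[e](y)=y'$ where $e\colon I_1\to X$, $e(0)=x,e(1)=x'$; it comes with the projection $\mathsf{Tot}_XF\to X$ ($y\in Fx\mapsto x$), which is a covering map. $\mathsf{Tot}_X$ sends a natural transformation $\alpha$ to $\coprod_x\alpha_x$. -}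

module Defs where

open import Data.Nat using (ℕ; zero; suc; _+_; z≤n)
open import Data.Nat.Properties using (1+n≢n; suc-injective)
open import Data.Fin as Fin using (Fin; zero; suc; toℕ; fromℕ)
open import Data.Sum using (_⊎_; inj₁; inj₂)
open import Data.Product using (Σ; Σ-syntax; _×_; _,_; proj₁; proj₂)
open import Relation.Binary.PropositionalEquality using (_≡_; refl; sym; trans; cong; subst; module ≡-Reasoning)
open import Relation.Nullary using (¬_)
open import Function using (_∘_)

record Graph : Set₁ where
  field
    V       : Set
    _∼_     : V → V → Set
    ∼-sym   : ∀ {a b} → a ∼ b → b ∼ a
    ∼-irrefl : ∀ {a} → ¬ (a ∼ a)

open Graph using (V) public

infix 4 _⊢_∼_ _⊢_≈_
infix 30 _⟨_⟩
infixr 6 _∗_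

_⊢_∼_ : (G : Graph) → V G → V G → Set
G ⊢ a ∼ b = Graph._∼_ G a b

_⊢_≈_ : (G : Graph) → V G → V G → Set
G ⊢ a ≈ b = a ≡ b ⊎ G ⊢ a ∼ b

≈-sym : (G : Graph) {a b : V G} → G ⊢ a ≈ b → G ⊢ b ≈ a
≈-sym G (inj₁ e) = inj₁ (sym e)
≈-sym G (inj₂ h) = inj₂ (Graph.∼-sym G h)

record GraphMap (G H : Graph) : Set where
  constructor graphMap
  field
    fun  : V G → V H
    resp : ∀ {a b} → G ⊢ a ∼ b → H ⊢ fun a ≈ fun b

open GraphMap public

_∼I_ : ∀ {n} → Fin (suc n) → Fin (suc n) → Set
a ∼I b = toℕ b ≡ suc (toℕ a) ⊎ toℕ a ≡ suc (toℕ b)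

I : ℕ → Graph
I n = record
  { V = Fin (suc n)
  ; _∼_ = _∼I_
  ; ∼-sym = λ { (inj₁ e) → inj₂ e ; (inj₂ e) → inj₁ e }
  ; ∼-irrefl = λ { (inj₁ e) → 1+n≢n (sym e) ; (inj₂ e) → 1+n≢n (sym e) }
  }

_∼□_ : Fin 2 × Fin 2 → Fin 2 × Fin 2 → Set
(a , b) ∼□ (a' , b') = (a ≡ a' × ¬ (b ≡ b')) ⊎ (¬ (a ≡ a') × b ≡ b')

Square : Graph
Square = record
  { V = Fin 2 × Fin 2
  ; _∼_ = _∼□_
  ; ∼-sym = λ { (inj₁ (e , n)) → inj₁ (sym e , λ q → n (sym q))
              ; (inj₂ (n , e)) → inj₂ ((λ q → n (sym q)) , sym e) }
  ; ∼-irrefl = λ { (inj₁ (_ , n)) → n refl ; (inj₂ (n , _)) → n refl }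
  }

i0 i1 : Fin 2
i0 = zero
i1 = suc zero

j0 j1 j2 j3 : Fin 4
j0 = zero
j1 = suc zero
j2 = suc (suc zero)
j3 = suc (suc (suc zero))

record Path (X : Graph) (n : ℕ) (x x' : V X) : Set where
  constructor path
  field
    pmap  : GraphMap (I n) X
    start : fun pmap zero ≡ x
    end   : fun pmap (fromℕ n) ≡ x'

_⟨_⟩ : ∀ {X n x x'} → Path X n x x' → Fin (suc n) → V X
γ ⟨ i ⟩ = fun (Path.pmap γ) i

OrderPreserving : ∀ {m n} → (Fin (suc m) → Fin (suc n)) → Set
OrderPreserving r = ∀ i j → i Fin.≤ j → r i Fin.≤ r j

SurjectiveMap : ∀ {m n} → (Fin (suc m) → Fin (suc n)) → Set
SurjectiveMap {m} r = ∀ k → Σ[ i ∈ Fin (suc m) ] r i ≡ k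

-- Path homotopy: the path-components of the quotient of ∐_n P_n X(x,x')
-- by reparametrisation, i.e. the equivalence relation generated by
--  * γ ∘ r ~ γ  for r : I_m → I_n surjective and order-preserving
--  * adjacency in P_n X(x,x') (pointwise equal-or-adjacent)
data _≃ₚ_ {X : Graph} {x x' : V X} : ∀ {m n} → Path X m x x' → Path X n x x' → Set where
  reparam  : ∀ {m n} (γ : Path X m x x') (δ : Path X n x x')
             (r : Fin (suc m) → Fin (suc n)) → OrderPreserving r → SurjectiveMap r →
             (∀ i → γ ⟨ i ⟩ ≡ δ ⟨ r i ⟩) → γ ≃ₚ δ
  adjacent : ∀ {n} (γ δ : Path X n x x') → (∀ i → X ⊢ γ ⟨ i ⟩ ≈ δ ⟨ i ⟩) → γ ≃ₚ δ
  ≃ₚ-refl  : ∀ {n} {γ : Path X n x x'} → γ ≃ₚ γ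
  ≃ₚ-sym   : ∀ {m n} {γ : Path X m x x'} {δ : Path X n x x'} → γ ≃ₚ δ → δ ≃ₚ γ
  ≃ₚ-trans : ∀ {m n k} {γ : Path X m x x'} {δ : Path X n x x'} {ε : Path X k x x'} →
             γ ≃ₚ δ → δ ≃ₚ ε → γ ≃ₚ ε

constPath : ∀ {X : Graph} n (x : V X) → Path X n x x
constPath n x = path (graphMap (λ _ → x) (λ _ → inj₁ refl)) refl refl

idPath : ∀ {X : Graph} (x : V X) → Path X 0 x x
idPath x = constPath 0 x

edgeFun : ∀ {X : Graph} (x x' : V X) → Fin 2 → V X
edgeFun {X} x x' zero = x
edgeFun {X} x x' (suc zero) = x'

edgePath : ∀ {X : Graph} {x x' : V X} → X ⊢ x ∼ x' → Path X 1 x x'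
edgePath {X} {x} {x'} h = path (graphMap (edgeFun {X} x x') rsp) refl refl
  where
  rsp : ∀ {a b : Fin 2} → a ∼I b → X ⊢ edgeFun {X} x x' a ≈ edgeFun {X} x x' b
  rsp {zero} {zero} _ = inj₁ refl
  rsp {zero} {suc zero} _ = inj₂ h
  rsp {suc zero} {zero} _ = inj₂ (Graph.∼-sym X h)
  rsp {suc zero} {suc zero} _ = inj₁ refl

RespI : ∀ (X : Graph) {k} → (Fin (suc k) → V X) → Set
RespI X {k} h = ∀ {a b : Fin (suc k)} → a ∼I b → X ⊢ h a ≈ h b

cat : ∀ {A : Set} m {n} → (Fin (suc m) → A) → (Fin (suc n) → A) → Fin (suc (m + n)) → A
cat zero f g i = g i
cat (suc m) f g zero = f zero
cat (suc m) f g (suc i) = cat m (f ∘ suc) g i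

respTail : ∀ {X : Graph} {k} {h : Fin (suc (suc k)) → V X} → RespI X h → RespI X (h ∘ suc)
respTail r (inj₁ e) = r (inj₁ (cong suc e))
respTail r (inj₂ e) = r (inj₂ (cong suc e))

catHead : ∀ {A : Set} m {n} (f : Fin (suc m) → A) (g : Fin (suc n) → A) →
          f (fromℕ m) ≡ g zero → cat m f g zero ≡ f zero
catHead zero f g e = sym e
catHead (suc m) f g e = refl

catEnd : ∀ {A : Set} m {n} (f : Fin (suc m) → A) (g : Fin (suc n) → A) →
         cat m f g (fromℕ (m + n)) ≡ g (fromℕ n)
catEnd zero f g = refl
catEnd (suc m) f g = catEnd m (f ∘ suc) g

respCat : ∀ {X : Graph} m {n} (f : Fin (suc m) → V X) (g : Fin (suc n) → V X) →
          RespI X f → RespI X g → f (fromℕ m) ≡ g zero → RespI X (cat m f g)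
respCat zero f g rf rg e = rg
respCat (suc m) f g rf rg e {zero} {zero} (inj₁ ())
respCat (suc m) f g rf rg e {zero} {zero} (inj₂ ())
respCat {X} (suc m) f g rf rg e {zero} {suc zero} (inj₁ refl) =
  subst (λ z → X ⊢ f zero ≈ z) (sym (catHead m (f ∘ suc) g e)) (rf (inj₁ refl))
respCat (suc m) f g rf rg e {zero} {suc (suc b)} (inj₁ ())
respCat (suc m) f g rf rg e {zero} {suc b} (inj₂ ())
respCat {X} (suc m) f g rf rg e {suc zero} {zero} (inj₂ refl) =
  ≈-sym X (subst (λ z → X ⊢ f zero ≈ z) (sym (catHead m (f ∘ suc) g e)) (rf (inj₁ refl)))
respCat (suc m) f g rf rg e {suc (suc a)} {zero} (inj₂ ())
respCat (suc m) f g rf rg e {suc a} {zero} (inj₁ ())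
respCat {X} (suc m) f g rf rg e {suc a} {suc b} (inj₁ q) =
  respCat {X} m (f ∘ suc) g (respTail {X} rf) rg e (inj₁ (suc-injective q))
respCat {X} (suc m) f g rf rg e {suc a} {suc b} (inj₂ q) =
  respCat {X} m (f ∘ suc) g (respTail {X} rf) rg e (inj₂ (suc-injective q))

_∗_ : ∀ {X : Graph} {m n} {x x' x'' : V X} → Path X m x x' → Path X n x' x'' → Path X (m + n) x x''
_∗_ {X} {m} {n} γ σ =
  path (graphMap (cat m (γ ⟨_⟩) (σ ⟨_⟩))
                 (respCat {X} m (γ ⟨_⟩) (σ ⟨_⟩) (resp (Path.pmap γ)) (resp (Path.pmap σ))
                          (trans (Path.end γ) (sym (Path.start σ)))))
       (trans (catHead m (γ ⟨_⟩) (σ ⟨_⟩) (trans (Path.end γ) (sym (Path.start σ)))) (Path.start γ))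
       (trans (catEnd m (γ ⟨_⟩) (σ ⟨_⟩)) (Path.end σ))

-- A morphism [γ] : x → x' of Π₁X is a homotopy class
-- of paths; a functor is given on representatives, respecting ≃ₚ.
-- Identity of Π₁X at x is [constant path of length 0]; [σ] ∘ [γ] = [γ ∗ σ].
-- Equality of functions (morphisms of Set) is pointwise.

record RawPFunctor (X : Graph) : Set₁ where
  field
    F₀ : V X → Set
    F₁ : ∀ {n x x'} → Path X n x x' → F₀ x → F₀ x'

open RawPFunctor public

record IsPFunctor {X : Graph} (F : RawPFunctor X) : Set where
  field
    F-resp : ∀ {m n x x'} {γ : Path X m x x'} {δ : Path X n x x'} →
             γ ≃ₚ δ → ∀ a → F₁ F γ a ≡ F₁ F δ a
    F-id   : ∀ {x} (a : F₀ F x) → F₁ F (idPath x) a ≡ a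
    F-comp : ∀ {m n x x' x''} (γ : Path X m x x') (σ : Path X n x' x'') (a : F₀ F x) →
             F₁ F (γ ∗ σ) a ≡ F₁ F σ (F₁ F γ a)

record PFunctor (X : Graph) : Set₁ where
  constructor pfunctor
  field
    raw       : RawPFunctor X
    isFunctor : IsPFunctor raw

open PFunctor public

Components : ∀ {X : Graph} → RawPFunctor X → RawPFunctor X → Set
Components {X} F G = ∀ (x : V X) → F₀ F x → F₀ G x

IsNatural : ∀ {X : Graph} (F G : RawPFunctor X) → Components F G → Set
IsNatural {X} F G α = ∀ {n} {x x' : V X} (γ : Path X n x x') (a : F₀ F x) →
                      α x' (F₁ F γ a) ≡ F₁ G γ (α x a)

record NatTrans {X : Graph} (F G : RawPFunctor X) : Set where
  constructor natTrans
  field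
    comp    : Components F G
    natural : IsNatural F G comp

open NatTrans public

record NatIso {X : Graph} (F G : RawPFunctor X) : Set where
  field
    to    : NatTrans F G
    from  : NatTrans G F
    from∘to : ∀ x a → comp from x (comp to x a) ≡ a
    to∘from : ∀ x b → comp to x (comp from x b) ≡ b

-- condition (i): p restricts to a bijection {y} ∪ N(y) → {p y} ∪ N(p y)
record LocalBijection {Y X : Graph} (p : GraphMap Y X) : Set where
  field
    loc-inj  : ∀ {y a b} → Y ⊢ y ≈ a → Y ⊢ y ≈ b → fun p a ≡ fun p b → a ≡ b
    loc-surj : ∀ {y x'} → X ⊢ fun p y ≈ x' → Σ[ y' ∈ V Y ] (Y ⊢ y ≈ y' × fun p y' ≡ x')

SquareCondition : {Y X : Graph} (p : GraphMap Y X) → Set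
SquareCondition {Y} {X} p =
  ∀ (u : GraphMap (I 3) Y) (v : GraphMap Square X) →
  fun p (fun u j0) ≡ fun v (i1 , i0) →
  fun p (fun u j1) ≡ fun v (i0 , i0) →
  fun p (fun u j2) ≡ fun v (i0 , i1) →
  fun p (fun u j3) ≡ fun v (i1 , i1) →
  Y ⊢ fun u j0 ≈ fun u j3

record IsCovering {Y X : Graph} (p : GraphMap Y X) : Set where
  field
    localBijection  : LocalBijection p
    squareCondition : SquareCondition p

record Covering (X : Graph) : Set₁ where
  constructor covering
  field
    Y          : Graph
    p          : GraphMap Y X
    isCovering : IsCovering p

record CovHom {X : Graph} (P Q : Covering X) : Set where
  constructor covHom
  field
    hom  : GraphMap (Covering.Y P) (Covering.Y Q)
    over : ∀ y → fun (Covering.p Q) (fun hom y) ≡ fun (Covering.p P) y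

open CovHom public

-- isomorphisms in Cov(X) (equality of graph maps is pointwise)
record CovIso {X : Graph} (P Q : Covering X) : Set where
  field
    to   : CovHom P Q
    from : CovHom Q P
    from∘to : ∀ y → fun (hom from) (fun (hom to) y) ≡ y
    to∘from : ∀ y → fun (hom to) (fun (hom from) y) ≡ y

Fiber : ∀ {Y X : Graph} → GraphMap Y X → V X → Set
Fiber {Y} p x = Σ[ y ∈ V Y ] fun p y ≡ x

module Lifting {Y X : Graph} (p : GraphMap Y X) (L : LocalBijection p) where
  open LocalBijection L

  step : ∀ {n} (f : Fin (suc (suc n)) → V X) → RespI X f → (y : V Y) → fun p y ≡ f zero →
         Σ[ y' ∈ V Y ] (Y ⊢ y ≈ y' × fun p y' ≡ f (suc zero))
  step f r y e = loc-surj (subst (λ z → X ⊢ z ≈ f (suc zero)) (sym e) (r (inj₁ refl)))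

  liftFun : ∀ n (f : Fin (suc n) → V X) → RespI X f → (y : V Y) → fun p y ≡ f zero →
            Fin (suc n) → V Y
  liftFun zero f r y e i = y
  liftFun (suc n) f r y e zero = y
  liftFun (suc n) f r y e (suc i) =
    liftFun n (f ∘ suc) (respTail {X} r) (proj₁ (step f r y e)) (proj₂ (proj₂ (step f r y e))) i

  liftOver : ∀ n (f : Fin (suc n) → V X) (r : RespI X f) (y : V Y) (e : fun p y ≡ f zero) →
             ∀ i → fun p (liftFun n f r y e i) ≡ f i
  liftOver zero f r y e zero = e
  liftOver (suc n) f r y e zero = e
  liftOver (suc n) f r y e (suc i) =
    liftOver n (f ∘ suc) (respTail {X} r) (proj₁ (step f r y e)) (proj₂ (proj₂ (step f r y e))) i

  unw : ∀ {n x x'} → Path X n x x' → Fiber p x → Fiber p x'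
  unw {n} γ (y , e) =
    liftFun n (γ ⟨_⟩) (resp (Path.pmap γ)) y (trans e (sym (Path.start γ))) (fromℕ n) ,
    trans (liftOver n (γ ⟨_⟩) (resp (Path.pmap γ)) y _ (fromℕ n)) (Path.end γ)

FibRaw : ∀ {X : Graph} → Covering X → RawPFunctor X
FibRaw P = record
  { F₀ = Fiber (Covering.p P)
  ; F₁ = Lifting.unw (Covering.p P) (IsCovering.localBijection (Covering.isCovering P))
  }

Fib : ∀ {X : Graph} → ((P : Covering X) → IsPFunctor (FibRaw P)) → Covering X → PFunctor X
Fib fibF P = pfunctor (FibRaw P) (fibF P)

fibComponents : ∀ {X : Graph} {P Q : Covering X} → CovHom P Q → Components (FibRaw P) (FibRaw Q)
fibComponents f x (y , e) = fun (hom f) y , trans (over f y) e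

FibHom : ∀ {X : Graph} {P Q : Covering X} →
         ((P Q : Covering X) (f : CovHom P Q) → IsNatural (FibRaw P) (FibRaw Q) (fibComponents f)) →
         CovHom P Q → NatTrans (FibRaw P) (FibRaw Q)
FibHom {P = P} {Q} nat f = natTrans (fibComponents f) (nat P Q f)

module _ {X : Graph} (F : PFunctor X) where
  private
    R = raw F
    module L = IsPFunctor (isFunctor F)

  _∼T_ : Σ (V X) (F₀ R) → Σ (V X) (F₀ R) → Set
  (x , a) ∼T (x' , b) = Σ[ h ∈ X ⊢ x ∼ x' ] F₁ R (edgePath h) a ≡ b

  private
    backForth : ∀ {x x' : V X} (h : X ⊢ x ∼ x') (h' : X ⊢ x' ∼ x) →
                (edgePath h ∗ edgePath h') ≃ₚ idPath x
    backForth {x} {x'} h h' =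
      ≃ₚ-trans (adjacent (edgePath {X} h ∗ edgePath {X} h') (constPath {X} 2 x) pw)
               (reparam (constPath {X} 2 x) (idPath {X} x) (λ _ → zero)
                        (λ _ _ _ → z≤n) (λ { zero → zero , refl }) (λ _ → refl))
      where
      pw : ∀ i → X ⊢ (edgePath {X} h ∗ edgePath {X} h') ⟨ i ⟩ ≈ x
      pw zero = inj₁ refl
      pw (suc zero) = inj₂ h'
      pw (suc (suc zero)) = inj₁ refl

    symT : ∀ {u v} → u ∼T v → v ∼T u
    symT {x , a} {x' , b} (h , e) = h' ,
      (begin
        F₁ R (edgePath h') b
      ≡⟨ cong (F₁ R (edgePath h')) (sym e) ⟩
        F₁ R (edgePath h') (F₁ R (edgePath h) a)
      ≡⟨ sym (L.F-comp (edgePath h) (edgePath h') a) ⟩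
        F₁ R (edgePath h ∗ edgePath h') a
      ≡⟨ L.F-resp (backForth h h') a ⟩
        F₁ R (idPath x) a
      ≡⟨ L.F-id a ⟩
        a
      ∎)
      where
      open ≡-Reasoning
      h' = Graph.∼-sym X h

  TotGraph : Graph
  TotGraph = record
    { V = Σ (V X) (F₀ R)
    ; _∼_ = _∼T_
    ; ∼-sym = symT
    ; ∼-irrefl = λ { (h , _) → Graph.∼-irrefl X h }
    }

  totProj : GraphMap TotGraph X
  totProj = graphMap proj₁ (λ { (h , _) → inj₂ h })

Tot : ∀ {X : Graph} → ((F : PFunctor X) → IsCovering (totProj F)) → PFunctor X → Covering X
Tot totCov F = covering (TotGraph F) (totProj F) (totCov F)

totMap : ∀ {X : Graph} {F G : PFunctor X} → NatTrans (raw F) (raw G) → GraphMap (TotGraph F) (TotGraph G)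
totMap {X} {F} {G} α = graphMap (λ { (x , a) → x , comp α x a }) rsp
  where
  rsp : ∀ {u v} → TotGraph F ⊢ u ∼ v → TotGraph G ⊢ (proj₁ u , comp α (proj₁ u) (proj₂ u)) ≈ (proj₁ v , comp α (proj₁ v) (proj₂ v))
  rsp {x , a} {x' , b} (h , e) = inj₂ (h , trans (sym (natural α (edgePath h) a)) (cong (comp α x') e))

TotHom : ∀ {X : Graph} (totCov : (F : PFunctor X) → IsCovering (totProj F)) {F G : PFunctor X} →
         NatTrans (raw F) (raw G) → CovHom (Tot totCov F) (Tot totCov G)
TotHom totCov {F} {G} α = covHom (totMap {F = F} {G = G} α) (λ _ → refl)

-- Path lifting in a covering is unique by local injectivity, and homotopy invariant: a
-- reparametrised path lifts to the reparametrised lift, and for pointwise-close paths the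
-- square condition carries closeness of the lifts from each step to the next, so their
-- endpoints are close and, lying over the same vertex, equal. Hence unwinding makes
-- x ↦ p⁻¹(x) a functor on Π₁X. Conversely each F[e] is a function, so Tot F → X is a local
-- bijection, and the square condition for Tot F is F applied to the homotopy between the
-- walk around a square and its diagonal. The unit sends y to (p y, y); the counit identifies
-- the fibre of Tot F over x with F x, and is natural because the lift in Tot F of a path γ
-- from a ends at F[γ] a.

module Submission where

open import Defs
open import Data.Product using (Σ; Σ-syntax; _×_; _,_)
open import Relation.Binary.PropositionalEquality using (_≡_)

open import Axiom.UniquenessOfIdentityProofs.WithK using (uip)
open import Data.Product using (proj₁; proj₂)
open import Data.Sum using (_⊎_; inj₁; inj₂)
open import Data.Empty using (⊥-elim)
open import Data.Nat as ℕ using (ℕ; zero; suc; z≤n)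
import Data.Nat.Properties as ℕ
open import Data.Fin using (Fin; zero; suc; toℕ; fromℕ; fromℕ<)
open import Data.Fin.Properties using (toℕ-injective; toℕ<n; ≤fromℕ; toℕ-fromℕ<)
open import Relation.Binary.PropositionalEquality using (refl; sym; trans; cong; subst; module ≡-Reasoning)
open import Relation.Nullary using (¬_; yes; no)
open import Function using (_∘_)

≈-map : ∀ {G H : Graph} (f : GraphMap G H) {a b} → G ⊢ a ≈ b → H ⊢ fun f a ≈ fun f b
≈-map f (inj₁ refl) = inj₁ refl
≈-map f (inj₂ h) = resp f h

≈-subst : ∀ {G : Graph} {a a' b b'} → a ≡ a' → b ≡ b' → G ⊢ a ≈ b → G ⊢ a' ≈ b'
≈-subst refl refl q = q

stepPath : ∀ {G : Graph} {x x' : V G} → G ⊢ x ≈ x' → Path G 1 x x'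
stepPath {G} {x} {x'} q = path (graphMap (edgeFun {G} x x') rsp) refl refl
  where
  rsp : ∀ {a b : Fin 2} → a ∼I b → G ⊢ edgeFun {G} x x' a ≈ edgeFun {G} x x' b
  rsp {zero} {zero} _ = inj₁ refl
  rsp {zero} {suc zero} _ = q
  rsp {suc zero} {zero} _ = ≈-sym G q
  rsp {suc zero} {suc zero} _ = inj₁ refl

pathOf : ∀ {G : Graph} {n} (f : Fin (suc n) → V G) → RespI G f → Path G n (f zero) (f (fromℕ n))
pathOf f r = path (graphMap f r) refl refl

≗⇒≃ₚ : ∀ {G : Graph} {n} {x x' : V G} (γ δ : Path G n x x') → (∀ i → γ ⟨ i ⟩ ≡ δ ⟨ i ⟩) → γ ≃ₚ δ
≗⇒≃ₚ γ δ e = adjacent γ δ (λ i → inj₁ (e i))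

stepPath-refl : ∀ {G : Graph} (x : V G) → stepPath {G} {x} (inj₁ refl) ≃ₚ idPath x
stepPath-refl {G} x = reparam (stepPath {G} (inj₁ refl)) (idPath x) (λ _ → zero)
                              (λ _ _ _ → z≤n) (λ { zero → zero , refl }) (λ { zero → refl ; (suc zero) → refl })

stepPath-irrelevant : ∀ {G : Graph} {x x' : V G} (q q' : G ⊢ x ≈ x') → stepPath {G} q ≃ₚ stepPath {G} q'
stepPath-irrelevant {G} q q' = ≗⇒≃ₚ (stepPath {G} q) (stepPath {G} q') (λ { zero → refl ; (suc zero) → refl })

edgePath≃ₚstepPath : ∀ {G : Graph} {x x' : V G} (h : G ⊢ x ∼ x') → edgePath {G} h ≃ₚ stepPath {G} (inj₂ h)
edgePath≃ₚstepPath {G} h = ≗⇒≃ₚ (edgePath {G} h) (stepPath {G} (inj₂ h)) (λ { zero → refl ; (suc zero) → refl })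

pathOf-uncons : ∀ {G : Graph} {n} (f : Fin (suc (suc n)) → V G) (r : RespI G f) →
                pathOf {G} f r ≃ₚ (stepPath {G} (r (inj₁ refl)) ∗ pathOf {G} (f ∘ suc) (respTail {G} r))
pathOf-uncons {G} f r = ≗⇒≃ₚ _ _ (λ { zero → refl ; (suc i) → refl })

-- The walk B → A → C → D around a square is pointwise close to B → B → D → D, the diagonal B → D padded.
square-walk : ∀ {G : Graph} {A B C D : V G} (q₁ : G ⊢ B ≈ A) (q₂ : G ⊢ A ≈ C) (q₃ : G ⊢ C ≈ D) →
              G ⊢ A ≈ B → G ⊢ C ≈ D → (bd : G ⊢ B ≈ D) →
              (stepPath {G} q₁ ∗ (stepPath {G} q₂ ∗ stepPath {G} q₃))
                ≃ₚ ((stepPath {G} {B} (inj₁ refl) ∗ stepPath {G} bd) ∗ stepPath {G} {D} (inj₁ refl))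
square-walk {G} {B = B} q₁ q₂ q₃ ab cd bd = adjacent _ _ close
  where
  close : ∀ i → G ⊢ (stepPath {G} q₁ ∗ (stepPath {G} q₂ ∗ stepPath {G} q₃)) ⟨ i ⟩
                  ≈ ((stepPath {G} {B} (inj₁ refl) ∗ stepPath {G} bd) ∗ stepPath {G} (inj₁ refl)) ⟨ i ⟩
  close zero = inj₁ refl
  close (suc zero) = ab
  close (suc (suc zero)) = cd
  close (suc (suc (suc zero))) = inj₁ refl

respI-zero : ∀ {G : Graph} (g : Fin 1 → V G) → RespI G g
respI-zero g {zero} {zero} _ = inj₁ refl

respI-cons : ∀ {G : Graph} {k} (g : Fin (suc (suc k)) → V G) → G ⊢ g zero ≈ g (suc zero) →
             RespI G (g ∘ suc) → RespI G g
respI-cons g h t {zero} {zero} _ = inj₁ refl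
respI-cons g h t {zero} {suc zero} _ = h
respI-cons g h t {zero} {suc (suc b)} (inj₁ ())
respI-cons g h t {zero} {suc (suc b)} (inj₂ ())
respI-cons {G} g h t {suc zero} {zero} _ = ≈-sym G h
respI-cons g h t {suc (suc a)} {zero} (inj₂ ())
respI-cons g h t {suc (suc a)} {zero} (inj₁ ())
respI-cons g h t {suc a} {suc b} (inj₁ q) = t (inj₁ (ℕ.suc-injective q))
respI-cons g h t {suc a} {suc b} (inj₂ q) = t (inj₂ (ℕ.suc-injective q))

cat-over : ∀ {A B : Set} (p : A → B) m {n} (g₁ : Fin (suc m) → A) (g₂ : Fin (suc n) → A)
           (f₁ : Fin (suc m) → B) (f₂ : Fin (suc n) → B) →
           (∀ i → p (g₁ i) ≡ f₁ i) → (∀ i → p (g₂ i) ≡ f₂ i) → ∀ i → p (cat m g₁ g₂ i) ≡ cat m f₁ f₂ i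
cat-over p zero g₁ g₂ f₁ f₂ o₁ o₂ i = o₂ i
cat-over p (suc m) g₁ g₂ f₁ f₂ o₁ o₂ zero = o₁ zero
cat-over p (suc m) g₁ g₂ f₁ f₂ o₁ o₂ (suc i) = cat-over p m (g₁ ∘ suc) g₂ (f₁ ∘ suc) f₂ (o₁ ∘ suc) o₂ i

squareFun : ∀ {G : Graph} (A B C D : V G) → Fin 2 × Fin 2 → V G
squareFun A B C D (zero , zero) = A
squareFun A B C D (suc zero , zero) = B
squareFun A B C D (zero , suc zero) = C
squareFun A B C D (suc zero , suc zero) = D

squareMap : ∀ {G : Graph} (A B C D : V G) → G ⊢ A ≈ B → G ⊢ A ≈ C → G ⊢ B ≈ D → G ⊢ C ≈ D →
            GraphMap Square G
squareMap {G} A B C D ab ac bd cd = graphMap (squareFun {G} A B C D) rsp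
  where
  rsp : ∀ {u v} → Square ⊢ u ∼ v → G ⊢ squareFun {G} A B C D u ≈ squareFun {G} A B C D v
  rsp {zero , zero} {suc zero , zero} _ = ab
  rsp {zero , zero} {zero , suc zero} _ = ac
  rsp {suc zero , zero} {suc zero , suc zero} _ = bd
  rsp {zero , suc zero} {suc zero , suc zero} _ = cd
  rsp {suc zero , zero} {zero , zero} _ = ≈-sym G ab
  rsp {zero , suc zero} {zero , zero} _ = ≈-sym G ac
  rsp {suc zero , suc zero} {suc zero , zero} _ = ≈-sym G bd
  rsp {suc zero , suc zero} {zero , suc zero} _ = ≈-sym G cd
  rsp {zero , zero} {zero , zero} _ = inj₁ refl
  rsp {suc zero , zero} {suc zero , zero} _ = inj₁ refl
  rsp {zero , suc zero} {zero , suc zero} _ = inj₁ refl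
  rsp {suc zero , suc zero} {suc zero , suc zero} _ = inj₁ refl
  rsp {zero , zero} {suc zero , suc zero} (inj₁ (() , _))
  rsp {zero , zero} {suc zero , suc zero} (inj₂ (_ , ()))
  rsp {suc zero , zero} {zero , suc zero} (inj₁ (() , _))
  rsp {suc zero , zero} {zero , suc zero} (inj₂ (_ , ()))
  rsp {zero , suc zero} {suc zero , zero} (inj₁ (() , _))
  rsp {zero , suc zero} {suc zero , zero} (inj₂ (_ , ()))
  rsp {suc zero , suc zero} {zero , zero} (inj₁ (() , _))
  rsp {suc zero , suc zero} {zero , zero} (inj₂ (_ , ()))

-- Surjective order-preserving maps I_m → I_n

module MonotoneSurjection {m n : ℕ} (r : Fin (suc m) → Fin (suc n))
                          (mono : OrderPreserving r) (surj : SurjectiveMap r) where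

  r-zero : r zero ≡ zero
  r-zero with surj zero
  ... | i , ri≡0 = toℕ-injective (ℕ.n≤0⇒n≡0 (subst (λ z → toℕ (r zero) ℕ.≤ toℕ z) ri≡0 (mono zero i z≤n)))

  r-last : r (fromℕ m) ≡ fromℕ n
  r-last with surj (fromℕ n)
  ... | i , ri≡n = toℕ-injective (ℕ.≤-antisym (≤fromℕ (r (fromℕ m)))
                     (subst (λ z → toℕ z ℕ.≤ toℕ (r (fromℕ m))) ri≡n (mono i (fromℕ m) (≤fromℕ i))))

  -- Surjectivity forbids skipping a value k: its preimage lies either left of a or right of b.
  no-gap : ∀ a b → toℕ b ≡ suc (toℕ a) → toℕ (r b) ℕ.≤ suc (toℕ (r a))
  no-gap a b b≡1+a = ℕ.≮⇒≥ gap
    where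
    gap : ¬ (suc (toℕ (r a)) ℕ.< toℕ (r b))
    gap ra<rb = unhit (surj (fromℕ< 1+ra<1+n))
      where
      1+ra<1+n = ℕ.<-trans ra<rb (toℕ<n (r b))
      unhit : ¬ (Σ[ i ∈ Fin (suc m) ] r i ≡ fromℕ< 1+ra<1+n)
      unhit (i , ri≡k) with toℕ i ℕ.≤? toℕ a
      ... | yes i≤a = ℕ.1+n≰n (subst (ℕ._≤ toℕ (r a)) ri≡1+ra (mono i a i≤a))
        where ri≡1+ra = trans (cong toℕ ri≡k) (toℕ-fromℕ< 1+ra<1+n)
      ... | no i≰a = ℕ.<-irrefl refl (ℕ.<-≤-trans ra<rb (subst (toℕ (r b) ℕ.≤_) ri≡1+ra (mono b i b≤i)))
        where
        ri≡1+ra = trans (cong toℕ ri≡k) (toℕ-fromℕ< 1+ra<1+n)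
        b≤i = subst (ℕ._≤ toℕ i) (sym b≡1+a) (ℕ.≰⇒> i≰a)

  step-resp : ∀ a b → toℕ b ≡ suc (toℕ a) → r a ≡ r b ⊎ toℕ (r b) ≡ suc (toℕ (r a))
  step-resp a b b≡1+a with ℕ.m≤n⇒m<n∨m≡n (no-gap a b b≡1+a)
  ... | inj₁ rb<1+ra = inj₁ (toℕ-injective (ℕ.≤-antisym ra≤rb (ℕ.≤-pred rb<1+ra)))
    where ra≤rb = mono a b (subst (toℕ a ℕ.≤_) (sym b≡1+a) (ℕ.n≤1+n _))
  ... | inj₂ rb≡1+ra = inj₂ rb≡1+ra

  ∼I-resp : ∀ {a b} → a ∼I b → r a ≡ r b ⊎ r a ∼I r b
  ∼I-resp {a} {b} (inj₁ q) with step-resp a b q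
  ... | inj₁ e = inj₁ e
  ... | inj₂ e = inj₂ (inj₁ e)
  ∼I-resp {a} {b} (inj₂ q) with step-resp b a q
  ... | inj₁ e = inj₁ (sym e)
  ... | inj₂ e = inj₂ (inj₂ e)

-- Unique path lifting along a local bijection

module UniqueLifting {Y X : Graph} (p : GraphMap Y X) (L : LocalBijection p) where
  open LocalBijection L
  open Lifting p L public

  lift-start : ∀ n (f : Fin (suc n) → V X) (r : RespI X f) y (e : fun p y ≡ f zero) →
               liftFun n f r y e zero ≡ y
  lift-start zero f r y e = refl
  lift-start (suc n) f r y e = refl

  lift-resp : ∀ n (f : Fin (suc n) → V X) (r : RespI X f) y (e : fun p y ≡ f zero) →
              RespI Y (liftFun n f r y e)
  lift-resp zero f r y e = respI-zero {Y} (liftFun zero f r y e)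
  lift-resp (suc n) f r y e =
    respI-cons {Y} (liftFun (suc n) f r y e) first-step
      (lift-resp n (f ∘ suc) (respTail {X} r) y₁ e₁)
    where
    y₁ = proj₁ (step f r y e)
    e₁ = proj₂ (proj₂ (step f r y e))
    first-step = subst (Y ⊢ y ≈_) (sym (lift-start n (f ∘ suc) (respTail {X} r) y₁ e₁))
                       (proj₁ (proj₂ (step f r y e)))

  lift-unique : ∀ n (f : Fin (suc n) → V X) (r : RespI X f) (y : V Y) (e : fun p y ≡ f zero)
                (g : Fin (suc n) → V Y) → RespI Y g → g zero ≡ y → (∀ i → fun p (g i) ≡ f i) →
                ∀ i → g i ≡ liftFun n f r y e i
  lift-unique zero f r y e g rg g0 g-over zero = g0
  lift-unique (suc n) f r y e g rg g0 g-over zero = g0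
  lift-unique (suc n) f r y e g rg g0 g-over (suc i) =
    lift-unique n (f ∘ suc) (respTail {X} r) y₁ e₁ (g ∘ suc) (respTail {Y} rg) g1≡y₁ (g-over ∘ suc) i
    where
    y₁ = proj₁ (step f r y e)
    e₁ = proj₂ (proj₂ (step f r y e))
    g1≡y₁ : g (suc zero) ≡ y₁
    g1≡y₁ = loc-inj (subst (λ z → Y ⊢ z ≈ g (suc zero)) g0 (rg (inj₁ refl))) (proj₁ (proj₂ (step f r y e)))
                    (trans (g-over (suc zero)) (sym e₁))

  Fiber-≡ : ∀ {x} {a b : Fiber p x} → proj₁ a ≡ proj₁ b → a ≡ b
  Fiber-≡ {a = y , e} {.y , e'} refl = cong (y ,_) (uip e e')

  unw-endpoint : ∀ {n x x'} (γ : Path X n x x') (y : V Y) (e : fun p y ≡ x) (g : Fin (suc n) → V Y) →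
                 RespI Y g → g zero ≡ y → (∀ i → fun p (g i) ≡ γ ⟨ i ⟩) →
                 proj₁ (unw γ (y , e)) ≡ g (fromℕ n)
  unw-endpoint {n} γ y e g rg g0 g-over =
    sym (lift-unique n (γ ⟨_⟩) (resp (Path.pmap γ)) y (trans e (sym (Path.start γ))) g rg g0 g-over (fromℕ n))

-- Fib_X is a functor Cov(X) → Set^{Π₁X}

module CoveringLifting {Y X : Graph} (p : GraphMap Y X) (C : IsCovering p) where
  open LocalBijection (IsCovering.localBijection C)
  open UniqueLifting p (IsCovering.localBijection C)

  -- The square condition, applied to the square spanned by one step of f₁ and one of f₂,
  -- carries closeness of the current lifted points to the next ones.
  lift-≈ : ∀ n (f₁ : Fin (suc n) → V X) (r₁ : RespI X f₁) y₁ (e₁ : fun p y₁ ≡ f₁ zero)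
             (f₂ : Fin (suc n) → V X) (r₂ : RespI X f₂) y₂ (e₂ : fun p y₂ ≡ f₂ zero) →
           (∀ i → X ⊢ f₁ i ≈ f₂ i) → Y ⊢ y₁ ≈ y₂ →
           ∀ i → Y ⊢ liftFun n f₁ r₁ y₁ e₁ i ≈ liftFun n f₂ r₂ y₂ e₂ i
  lift-≈ zero f₁ r₁ y₁ e₁ f₂ r₂ y₂ e₂ close h zero = h
  lift-≈ (suc n) f₁ r₁ y₁ e₁ f₂ r₂ y₂ e₂ close h zero = h
  lift-≈ (suc n) f₁ r₁ y₁ e₁ f₂ r₂ y₂ e₂ close h (suc i) =
    lift-≈ n (f₁ ∘ suc) (respTail {X} r₁) y₁' e₁' (f₂ ∘ suc) (respTail {X} r₂) y₂' e₂' (close ∘ suc) h' i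
    where
    y₁' = proj₁ (step f₁ r₁ y₁ e₁)
    e₁' = proj₂ (proj₂ (step f₁ r₁ y₁ e₁))
    y₂' = proj₁ (step f₂ r₂ y₂ e₂)
    e₂' = proj₂ (proj₂ (step f₂ r₂ y₂ e₂))
    u : GraphMap (I 3) Y
    u = Path.pmap (stepPath {Y} (≈-sym Y (proj₁ (proj₂ (step f₁ r₁ y₁ e₁))))
                    ∗ (stepPath {Y} h ∗ stepPath {Y} (proj₁ (proj₂ (step f₂ r₂ y₂ e₂)))))
    v : GraphMap Square X
    v = squareMap {X} (f₁ zero) (f₁ (suc zero)) (f₂ zero) (f₂ (suc zero))
                  (r₁ (inj₁ refl)) (close zero) (close (suc zero)) (r₂ (inj₁ refl))
    h' : Y ⊢ y₁' ≈ y₂'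
    h' = IsCovering.squareCondition C u v e₁' e₁ e₂ e₂'

  unw-reparam : ∀ {m n x x'} (γ : Path X m x x') (δ : Path X n x x') (r : Fin (suc m) → Fin (suc n)) →
                OrderPreserving r → SurjectiveMap r → (∀ i → γ ⟨ i ⟩ ≡ δ ⟨ r i ⟩) →
                ∀ a → unw γ a ≡ unw δ a
  unw-reparam {m} {n} γ δ r mono surj γ≡δ∘r (y , e) =
    Fiber-≡ (trans (unw-endpoint γ y e (lift-δ ∘ r) resp-lift-δ∘r start over-γ) (cong lift-δ r-last))
    where
    open MonotoneSurjection r mono surj
    eδ = trans e (sym (Path.start δ))
    lift-δ = liftFun n (δ ⟨_⟩) (resp (Path.pmap δ)) y eδ
    resp-lift-δ∘r : RespI Y (lift-δ ∘ r)
    resp-lift-δ∘r ab with ∼I-resp ab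
    ... | inj₁ ra≡rb = inj₁ (cong lift-δ ra≡rb)
    ... | inj₂ ra∼rb = lift-resp n (δ ⟨_⟩) (resp (Path.pmap δ)) y eδ ra∼rb
    start = trans (cong lift-δ r-zero) (lift-start n (δ ⟨_⟩) (resp (Path.pmap δ)) y eδ)
    over-γ : ∀ i → fun p (lift-δ (r i)) ≡ γ ⟨ i ⟩
    over-γ i = trans (liftOver n (δ ⟨_⟩) (resp (Path.pmap δ)) y eδ (r i)) (sym (γ≡δ∘r i))

  unw-adjacent : ∀ {n x x'} (γ δ : Path X n x x') → (∀ i → X ⊢ γ ⟨ i ⟩ ≈ δ ⟨ i ⟩) →
                 ∀ a → unw γ a ≡ unw δ a
  unw-adjacent {n} γ δ close (y , e) =
    Fiber-≡ (loc-inj (inj₁ refl)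
      (lift-≈ n (γ ⟨_⟩) (resp (Path.pmap γ)) y (trans e (sym (Path.start γ)))
                (δ ⟨_⟩) (resp (Path.pmap δ)) y (trans e (sym (Path.start δ))) close (inj₁ refl) (fromℕ n))
      (trans (proj₂ (unw γ (y , e))) (sym (proj₂ (unw δ (y , e))))))

  unw-resp-≃ₚ : ∀ {m n x x'} {γ : Path X m x x'} {δ : Path X n x x'} → γ ≃ₚ δ → ∀ a → unw γ a ≡ unw δ a
  unw-resp-≃ₚ (reparam γ δ r mono surj γ≡δ∘r) = unw-reparam γ δ r mono surj γ≡δ∘r
  unw-resp-≃ₚ (adjacent γ δ close) = unw-adjacent γ δ close
  unw-resp-≃ₚ ≃ₚ-refl a = refl
  unw-resp-≃ₚ (≃ₚ-sym h) a = sym (unw-resp-≃ₚ h a)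
  unw-resp-≃ₚ (≃ₚ-trans h k) a = trans (unw-resp-≃ₚ h a) (unw-resp-≃ₚ k a)

  unw-∗ : ∀ {m n x x' x''} (γ : Path X m x x') (σ : Path X n x' x'') (a : Fiber p x) →
          unw (γ ∗ σ) a ≡ unw σ (unw γ a)
  unw-∗ {m} {n} γ σ (y , e) =
    Fiber-≡ (trans (unw-endpoint (γ ∗ σ) y e (cat m lift-γ lift-σ) resp-cat start over-γ∗σ)
                   (catEnd m lift-γ lift-σ))
    where
    eγ = trans e (sym (Path.start γ))
    lift-γ = liftFun m (γ ⟨_⟩) (resp (Path.pmap γ)) y eγ
    mid = unw γ (y , e)
    eσ = trans (proj₂ mid) (sym (Path.start σ))
    lift-σ = liftFun n (σ ⟨_⟩) (resp (Path.pmap σ)) (proj₁ mid) eσ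
    join : lift-γ (fromℕ m) ≡ lift-σ zero
    join = sym (lift-start n (σ ⟨_⟩) (resp (Path.pmap σ)) (proj₁ mid) eσ)
    resp-cat = respCat {Y} m lift-γ lift-σ (lift-resp m (γ ⟨_⟩) (resp (Path.pmap γ)) y eγ)
                       (lift-resp n (σ ⟨_⟩) (resp (Path.pmap σ)) (proj₁ mid) eσ) join
    start = trans (catHead m lift-γ lift-σ join) (lift-start m (γ ⟨_⟩) (resp (Path.pmap γ)) y eγ)
    over-γ∗σ = cat-over (fun p) m lift-γ lift-σ (γ ⟨_⟩) (σ ⟨_⟩)
                    (liftOver m (γ ⟨_⟩) (resp (Path.pmap γ)) y eγ)
                    (liftOver n (σ ⟨_⟩) (resp (Path.pmap σ)) (proj₁ mid) eσ)

Fib-isFunctor : ∀ {X : Graph} (P : Covering X) → IsPFunctor (FibRaw P)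
Fib-isFunctor (covering Y p C) = record
  { F-resp = unw-resp-≃ₚ
  ; F-id = λ _ → Fiber-≡ refl
  ; F-comp = unw-∗
  }
  where
  open CoveringLifting p C
  open UniqueLifting p (IsCovering.localBijection C)

Fib-natural : ∀ {X : Graph} (P Q : Covering X) (f : CovHom P Q) →
              IsNatural (FibRaw P) (FibRaw Q) (fibComponents f)
Fib-natural {X} P Q f {n} γ (y , e) =
  Q.Fiber-≡ (sym (Q.unw-endpoint γ (fun (hom f) y) (trans (over f y) e) (fun (hom f) ∘ lift-γ) resp-f∘lift start over-γ))
  where
  module P = UniqueLifting (Covering.p P) (IsCovering.localBijection (Covering.isCovering P))
  module Q = UniqueLifting (Covering.p Q) (IsCovering.localBijection (Covering.isCovering Q))
  eγ = trans e (sym (Path.start γ))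
  lift-γ = P.liftFun n (γ ⟨_⟩) (resp (Path.pmap γ)) y eγ
  resp-f∘lift : RespI (Covering.Y Q) (fun (hom f) ∘ lift-γ)
  resp-f∘lift ab = ≈-map (hom f) (P.lift-resp n (γ ⟨_⟩) (resp (Path.pmap γ)) y eγ ab)
  start = cong (fun (hom f)) (P.lift-start n (γ ⟨_⟩) (resp (Path.pmap γ)) y eγ)
  over-γ : ∀ i → fun (Covering.p Q) (fun (hom f) (lift-γ i)) ≡ γ ⟨ i ⟩
  over-γ i = trans (over f (lift-γ i)) (P.liftOver n (γ ⟨_⟩) (resp (Path.pmap γ)) y eγ i)

-- Tot_X F is a covering of X

module TotCovering {X : Graph} (F : PFunctor X) where
  private
    R = raw F
    T = TotGraph F
  open IsPFunctor (isFunctor F)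

  F-step-refl : ∀ {x} (a : F₀ R x) → F₁ R (stepPath {X} {x} (inj₁ refl)) a ≡ a
  F-step-refl {x} a = trans (F-resp (stepPath-refl {X} x) a) (F-id a)

  Tot-≈⇒ : ∀ {x x' a b} → T ⊢ (x , a) ≈ (x' , b) → Σ[ q ∈ X ⊢ x ≈ x' ] F₁ R (stepPath {X} q) a ≡ b
  Tot-≈⇒ (inj₁ refl) = inj₁ refl , F-step-refl _
  Tot-≈⇒ (inj₂ (h , e)) = inj₂ h , trans (sym (F-resp (edgePath≃ₚstepPath {X} h) _)) e

  ⇒Tot-≈ : ∀ {x x' a b} (q : X ⊢ x ≈ x') → F₁ R (stepPath {X} q) a ≡ b → T ⊢ (x , a) ≈ (x' , b)
  ⇒Tot-≈ {x} (inj₁ refl) e = inj₁ (cong (x ,_) (trans (sym (F-step-refl _)) e))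
  ⇒Tot-≈ (inj₂ h) e = inj₂ (h , trans (F-resp (edgePath≃ₚstepPath {X} h) _) e)

  totProj-localBijection : LocalBijection (totProj F)
  totProj-localBijection = record { loc-inj = injective ; loc-surj = surjective }
    where
    injective : ∀ {y a b} → T ⊢ y ≈ a → T ⊢ y ≈ b → proj₁ a ≡ proj₁ b → a ≡ b
    injective (inj₁ refl) (inj₁ refl) _ = refl
    injective {x , _} (inj₁ refl) (inj₂ (h , _)) refl = ⊥-elim (Graph.∼-irrefl X h)
    injective {x , _} (inj₂ (h , _)) (inj₁ refl) refl = ⊥-elim (Graph.∼-irrefl X h)
    injective {x , c} (inj₂ (h , refl)) (inj₂ (h' , refl)) refl =
      cong (_ ,_) (F-resp (≗⇒≃ₚ (edgePath {X} h) (edgePath {X} h') (λ { zero → refl ; (suc zero) → refl })) c)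
    surjective : ∀ {y x'} → X ⊢ proj₁ y ≈ x' → Σ[ y' ∈ V T ] (T ⊢ y ≈ y' × proj₁ y' ≡ x')
    surjective {y} (inj₁ refl) = y , inj₁ refl , refl
    surjective {x , a} (inj₂ h) = (_ , F₁ R (edgePath {X} h) a) , inj₂ (h , refl) , refl

  F-square : ∀ {A B C D} (q₁ : X ⊢ B ≈ A) (q₂ : X ⊢ A ≈ C) (q₃ : X ⊢ C ≈ D) →
             X ⊢ A ≈ B → X ⊢ C ≈ D → (bd : X ⊢ B ≈ D) → (a : F₀ R B) →
             F₁ R (stepPath {X} q₃) (F₁ R (stepPath {X} q₂) (F₁ R (stepPath {X} q₁) a)) ≡ F₁ R (stepPath {X} bd) a
  F-square {A} {B} {C} {D} q₁ q₂ q₃ ab cd bd a =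
    begin
      F₁ R s₃ (F₁ R s₂ (F₁ R s₁ a))   ≡⟨ sym (F-comp s₂ s₃ _) ⟩
      F₁ R (s₂ ∗ s₃) (F₁ R s₁ a)      ≡⟨ sym (F-comp s₁ (s₂ ∗ s₃) a) ⟩
      F₁ R (s₁ ∗ (s₂ ∗ s₃)) a         ≡⟨ F-resp (square-walk {X} q₁ q₂ q₃ ab cd bd) a ⟩
      F₁ R ((s-B ∗ s-bd) ∗ s-D) a     ≡⟨ F-comp (s-B ∗ s-bd) s-D a ⟩
      F₁ R s-D (F₁ R (s-B ∗ s-bd) a)  ≡⟨ F-step-refl _ ⟩
      F₁ R (s-B ∗ s-bd) a             ≡⟨ F-comp s-B s-bd a ⟩
      F₁ R s-bd (F₁ R s-B a)          ≡⟨ cong (F₁ R s-bd) (F-step-refl a) ⟩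
      F₁ R s-bd a                     ∎
    where
    open ≡-Reasoning
    s₁ = stepPath {X} q₁
    s₂ = stepPath {X} q₂
    s₃ = stepPath {X} q₃
    s-B = stepPath {X} {B} (inj₁ refl)
    s-D = stepPath {X} {D} (inj₁ refl)
    s-bd = stepPath {X} bd

  Tot-square : ∀ {A B C D a₀ a₁ a₂ a₃} →
               T ⊢ (B , a₀) ≈ (A , a₁) → T ⊢ (A , a₁) ≈ (C , a₂) → T ⊢ (C , a₂) ≈ (D , a₃) →
               X ⊢ A ≈ B → X ⊢ C ≈ D → X ⊢ B ≈ D → T ⊢ (B , a₀) ≈ (D , a₃)
  Tot-square t₁ t₂ t₃ ab cd bd with Tot-≈⇒ t₁ | Tot-≈⇒ t₂ | Tot-≈⇒ t₃
  ... | q₁ , refl | q₂ , refl | q₃ , refl = ⇒Tot-≈ bd (sym (F-square q₁ q₂ q₃ ab cd bd _))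

  totProj-squareCondition : SquareCondition (totProj F)
  totProj-squareCondition u v e₀ e₁ e₂ e₃ =
    Tot-square (resp u {j0} {j1} (inj₁ refl)) (resp u {j1} {j2} (inj₁ refl)) (resp u {j2} {j3} (inj₁ refl))
      (≈-subst {X} (sym e₁) (sym e₀) (resp v {i0 , i0} {i1 , i0} (inj₂ ((λ ()) , refl))))
      (≈-subst {X} (sym e₂) (sym e₃) (resp v {i0 , i1} {i1 , i1} (inj₂ ((λ ()) , refl))))
      (≈-subst {X} (sym e₀) (sym e₃) (resp v {i1 , i0} {i1 , i1} (inj₁ (refl , (λ ())))))

Tot-isCovering : ∀ {X : Graph} (F : PFunctor X) → IsCovering (totProj F)
Tot-isCovering F = record
  { localBijection = TotCovering.totProj-localBijection F
  ; squareCondition = TotCovering.totProj-squareCondition F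
  }

-- The unit and counit of the equivalence

module TotLifting {X : Graph} (F : PFunctor X) where
  private
    R = raw F
    T = TotGraph F
  open IsPFunctor (isFunctor F)
  open TotCovering F
  open Lifting (totProj F) totProj-localBijection

  Tot-≈-transport : ∀ {x₀ x₁ z₀ z₁ : V X} (a : F₀ R x₀) (b : F₀ R x₁) → T ⊢ (x₀ , a) ≈ (x₁ , b) →
                    (e : x₀ ≡ z₀) (e' : x₁ ≡ z₁) (q : X ⊢ z₀ ≈ z₁) →
                    subst (F₀ R) e' b ≡ F₁ R (stepPath {X} q) (subst (F₀ R) e a)
  Tot-≈-transport a b t refl refl q with Tot-≈⇒ t
  ... | q' , refl = F-resp (stepPath-irrelevant {X} q' q) a

  lift-in-Tot : ∀ n (f : Fin (suc n) → V X) (r : RespI X f) (x₀ : V X) (a : F₀ R x₀) (e : x₀ ≡ f zero)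
                (o : proj₁ (liftFun n f r (x₀ , a) e (fromℕ n)) ≡ f (fromℕ n)) →
                subst (F₀ R) o (proj₂ (liftFun n f r (x₀ , a) e (fromℕ n)))
                  ≡ F₁ R (pathOf {X} f r) (subst (F₀ R) e a)
  lift-in-Tot zero f r x₀ a e o =
    begin
      subst (F₀ R) o a                           ≡⟨ cong (λ e' → subst (F₀ R) e' a) (uip o e) ⟩
      subst (F₀ R) e a                           ≡⟨ sym (F-id _) ⟩
      F₁ R (idPath (f zero)) (subst (F₀ R) e a)  ≡⟨ sym (F-resp constant _) ⟩
      F₁ R (pathOf {X} f r) (subst (F₀ R) e a)   ∎
    where
    open ≡-Reasoning
    constant = ≗⇒≃ₚ (pathOf {X} f r) (idPath (f zero)) (λ { zero → refl })
  lift-in-Tot (suc n) f r x₀ a e o =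
    begin
      subst (F₀ R) o (proj₂ (liftFun n (f ∘ suc) (respTail {X} r) y₁ e₁ (fromℕ n)))
        ≡⟨ lift-in-Tot n (f ∘ suc) (respTail {X} r) (proj₁ y₁) (proj₂ y₁) e₁ o ⟩
      F₁ R tail (subst (F₀ R) e₁ (proj₂ y₁))
        ≡⟨ cong (F₁ R tail) (Tot-≈-transport a (proj₂ y₁) (proj₁ (proj₂ (step f r (x₀ , a) e))) e e₁ f₀≈f₁) ⟩
      F₁ R tail (F₁ R (stepPath {X} f₀≈f₁) (subst (F₀ R) e a))
        ≡⟨ sym (F-comp (stepPath {X} f₀≈f₁) tail _) ⟩
      F₁ R (stepPath {X} f₀≈f₁ ∗ tail) (subst (F₀ R) e a)
        ≡⟨ sym (F-resp (pathOf-uncons {X} f r) _) ⟩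
      F₁ R (pathOf {X} f r) (subst (F₀ R) e a)
        ∎
    where
    open ≡-Reasoning
    y₁ = proj₁ (step f r (x₀ , a) e)
    e₁ = proj₂ (proj₂ (step f r (x₀ , a) e))
    f₀≈f₁ = r (inj₁ refl)
    tail = pathOf {X} (f ∘ suc) (respTail {X} r)

inverse-natural : ∀ {X : Graph} {F G : RawPFunctor X} (α : NatTrans F G) (β : Components G F) →
                  (∀ x a → comp α x (β x a) ≡ a) → (∀ x a → β x (comp α x a) ≡ a) → IsNatural G F β
inverse-natural {F = F} {G} α β αβ βα {x = x} {x'} γ b =
  begin
    β x' (F₁ G γ b)                   ≡⟨ cong (λ b' → β x' (F₁ G γ b')) (sym (αβ x b)) ⟩
    β x' (F₁ G γ (comp α x (β x b)))  ≡⟨ cong (β x') (sym (natural α γ (β x b))) ⟩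
    β x' (comp α x' (F₁ F γ (β x b))) ≡⟨ βα x' _ ⟩
    F₁ F γ (β x b)                    ∎
  where open ≡-Reasoning

counit : ∀ {X : Graph} (F : PFunctor X) → NatTrans (FibRaw (Tot Tot-isCovering F)) (raw F)
counit {X} F = natTrans transport transport-natural
  where
  transport : Components (FibRaw (Tot Tot-isCovering F)) (raw F)
  transport x ((x₁ , b) , o) = subst (F₀ (raw F)) o b
  transport-natural : IsNatural (FibRaw (Tot Tot-isCovering F)) (raw F) transport
  transport-natural {n} (path (graphMap f r) refl refl) ((x₀ , b) , e) =
    trans (TotLifting.lift-in-Tot F n f r x₀ b (trans e refl) _)
          (cong (λ e' → F₁ (raw F) (pathOf {X} f r) (subst (F₀ (raw F)) e' b)) (uip (trans e refl) e))

counit-iso : ∀ {X : Graph} (F : PFunctor X) → NatIso (FibRaw (Tot Tot-isCovering F)) (raw F)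
counit-iso {X} F = record
  { to = counit F
  ; from = natTrans section (inverse-natural (counit F) section (λ x a → refl) section-counit)
  ; from∘to = section-counit
  ; to∘from = λ x a → refl
  }
  where
  section : Components (raw F) (FibRaw (Tot Tot-isCovering F))
  section x b = (x , b) , refl
  section-counit : ∀ x a → section x (comp (counit F) x a) ≡ a
  section-counit x ((x₁ , b) , refl) = refl

unit-iso : ∀ {X : Graph} (P : Covering X) → CovIso P (Tot Tot-isCovering (Fib Fib-isFunctor P))
unit-iso {X} P@(covering Y p C) = record
  { to = covHom (graphMap toFiber toFiber-resp) (λ y → refl)
  ; from = covHom (graphMap point point-resp) (λ { (x , (y , e)) → e })
  ; from∘to = λ y → refl
  ; to∘from = λ { (x , (y , refl)) → refl }
  }
  where
  open LocalBijection (IsCovering.localBijection C)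
  open UniqueLifting p (IsCovering.localBijection C)
  T = Covering.Y (Tot Tot-isCovering (Fib Fib-isFunctor P))
  toFiber : V Y → V T
  toFiber y = fun p y , (y , refl)
  toFiber-resp : ∀ {y y'} → Y ⊢ y ∼ y' → T ⊢ toFiber y ≈ toFiber y'
  toFiber-resp {y} {y'} y∼y' with resp p y∼y'
  ... | inj₁ py≡py' = inj₁ (cong toFiber (loc-inj (inj₁ refl) (inj₂ y∼y') py≡py'))
  ... | inj₂ h = inj₂ (h , Fiber-≡ (unw-endpoint (edgePath {X} h) y refl (edgeFun {Y} y y')
                                      (resp (Path.pmap (stepPath {Y} (inj₂ y∼y')))) refl
                                      (λ { zero → refl ; (suc zero) → refl })))
  point : V T → V Y
  point (x , (y , e)) = y
  point-resp : ∀ {u v} → T ⊢ u ∼ v → Y ⊢ point u ≈ point v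
  point-resp {x , (y , e)} (h , refl) =
    lift-resp 1 (edgePath {X} h ⟨_⟩) (resp (Path.pmap (edgePath {X} h))) y (trans e refl) {zero} {suc zero} (inj₁ refl)

∐Fiber-≡ : ∀ {Y X : Graph} {q : GraphMap Y X} {w : V Y} {x₁ x₂ : V X} (e₁ : fun q w ≡ x₁) (e₂ : fun q w ≡ x₂) →
           _≡_ {A = Σ (V X) (Fiber q)} (x₁ , (w , e₁)) (x₂ , (w , e₂))
∐Fiber-≡ refl refl = refl

theorem4p22 : (X : Graph) →
    Σ[ fibFunctor ∈ ((P : Covering X) → IsPFunctor (FibRaw P)) ]
    Σ[ fibNatural ∈ ((P Q : Covering X) (f : CovHom P Q) →
                      IsNatural (FibRaw P) (FibRaw Q) (fibComponents f)) ]
    Σ[ totCovering ∈ ((F : PFunctor X) → IsCovering (totProj F)) ]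
    ((Σ[ η ∈ ((P : Covering X) → CovIso P (Tot totCovering (Fib fibFunctor P))) ]
        ((P Q : Covering X) (f : CovHom P Q) (y : V (Covering.Y P)) →
          fun (hom (CovIso.to (η Q))) (fun (hom f) y)
            ≡ fun (hom (TotHom totCovering {Fib fibFunctor P} {Fib fibFunctor Q} (FibHom fibNatural f)))
                  (fun (hom (CovIso.to (η P))) y)))
     ×
     (Σ[ ε ∈ ((F : PFunctor X) → NatIso (FibRaw (Tot totCovering F)) (raw F)) ]
        ((F G : PFunctor X) (α : NatTrans (raw F) (raw G)) (x : V X)
         (a : F₀ (FibRaw (Tot totCovering F)) x) →
          comp (NatIso.to (ε G)) x (comp (FibHom fibNatural (TotHom totCovering {F} {G} α)) x a)
            ≡ comp α x (comp (NatIso.to (ε F)) x a))))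
theorem4p22 X =
  Fib-isFunctor , Fib-natural , Tot-isCovering ,
  (unit-iso , λ P Q f y → ∐Fiber-≡ {q = Covering.p Q} refl (trans (over f y) refl)) ,
  (counit-iso , λ { F G α x ((x₁ , b) , refl) → refl })
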